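{- Let $1\le k,\ell<n$ be integers with $\gcd(k,\ell,n)=1$, $k\ne\ell$ and $k\ne n-\ell$. Then one of the following holds: (1) $1<\gcd(k,n)\le\sqrt{n}$ or $1<\gcd(\ell,n)\le\sqrt{n}$; (2) there are nonzero integers $r,u$ such that $|u|\le\sqrt{n}$, $rk\equiv 1\pmod n$, $u\,R_n(r\ell)\ne R_n(ur\ell)$, and $R_n(ur\ell)\le\sqrt{n}$; (3) there are nonzero integers $r,u$ such that $|u|\le\sqrt{n}$, $r\ell\equiv 1\pmod n$, $u\,R_n(rk)\ne R_n(urk)$, and $R_n(urk)\le\sqrt{n}$.
   Context: For $x\in\mathbb{R}$ and $m\in\mathbb{R}\setminus\{0\}$, $R_m(x)$ denotes the unique real number $c\in[-\frac{m}{2},\frac{m}{2})$ such that $x-c\in m\mathbb{Z}$. -}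

module Defs where

open import Data.Nat as ℕ using (ℕ; zero; suc)
open import Data.Integer as ℤ using (ℤ; +_; _+_; _-_; _*_; _≤_)
open import Data.Integer.DivMod using (_%ℕ_)
open import Data.Sum using (_⊎_)

-- R m x for a positive modulus m (given as a natural number):
-- the unique c ∈ [-m/2, m/2) with x - c ∈ mℤ.
-- With q = ⌊m/2⌋ the integers in [-m/2, m/2) are exactly -q, …, m-1-q,
-- so c = ((x + q) mod m) - q.
-- (For m = 0 the value is irrelevant; the statement only uses m = n ≥ 2.)
R : ℕ → ℤ → ℤ
R zero    x = x
R (suc m) x = + ((x + + h) %ℕ suc m) - + h
  where h = suc m ℕ./ 2

-- "x ≤ √n" for an integer x and natural n:  x ≤ 0, or x² ≤ n.
LeSqrt : ℤ → ℕ → Set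
LeSqrt x n = x ≤ + 0 ⊎ x * x ≤ + n

LeSqrtℕ : ℕ → ℕ → Set
LeSqrtℕ x n = x ℕ.* x ℕ.≤ n

module Submission where

-- Suppose gcd(k,n) = 1; by symmetry this is the only case left, since the coprime divisors
-- gcd(k,n) and gcd(ℓ,n) of n cannot both exceed √n.  Let r k ≡ 1 and m = R_n(r ℓ), so that
-- k m ≡ ℓ, and |m| ≥ 2 because ℓ ≢ 0, k, -k.  If m² ≤ n, then gcd(ℓ,n) divides m, so ℓ is
-- invertible (or alternative (1) holds), and for r′ ℓ ≡ 1 the multiplier u = m gives
-- R_n(m r′ k) = 1 ≠ m R_n(r′ k): alternative (3).  If m² > n, then u = ±⌊n/|m|⌋ satisfies
-- |u| < |m|, hence u² ≤ n, and n − |m| < u m ≤ n, hence R_n(u r ℓ) = u m − n ≤ 0 < u m: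
-- alternative (2).

open import Defs
open import Data.Nat as ℕ using (ℕ; _<_; _≤_)
open import Data.Nat.GCD using (gcd)
open import Data.Integer as ℤ using (ℤ; +_; _*_; ∣_∣)
open import Data.Integer.Divisibility using (_∣_)
open import Data.Integer.Base using (_-_)
open import Data.Product using (Σ; _×_)
open import Data.Sum using (_⊎_)
open import Relation.Binary.PropositionalEquality using (_≡_; _≢_)

open import Data.Empty using (⊥; ⊥-elim)
open import Data.Integer using (-_; _+_; 0ℤ; +[1+_]; -[1+_]; sign; _◃_)
open import Data.Integer.DivMod using (_%ℕ_; _/ℕ_; a≡a%ℕn+[a/ℕn]*n; n%ℕd<d)
import Data.Integer.Divisibility.Signed as Signed
import Data.Integer.Properties as ℤ
open import Algebra.Properties.AbelianGroup ℤ.+-0-abelianGroup using (∙-cancelʳ)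
open import Data.Integer.Tactic.RingSolver using (solve-∀)
open import Data.Nat using (zero; suc)
open import Data.Nat.Coprimality using (coprime-Bézout; gcd≡1⇒coprime)
import Data.Nat.Divisibility as ℕ
import Data.Nat.DivMod as ℕ
open import Data.Nat.GCD using (module Bézout; gcd[m,n]∣m; gcd[m,n]∣n; gcd-greatest; gcd[m,n]≡0⇒n≡0)
open import Data.Nat.LCM using (lcm; lcm-least; gcd*lcm)
import Data.Nat.Properties as ℕ
open import Data.Product using (_,_)
import Data.Sign.Base as Sign
import Data.Sign.Properties as Sign
open import Data.Sum using (inj₁; inj₂; swap; [_,_])
open import Function using (_∘_; _$_)
open import Relation.Binary.Bundles using (Setoid)
open import Relation.Binary.PropositionalEquality
  using (refl; sym; trans; cong; subst; subst₂; module ≡-Reasoning)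
open import Relation.Binary.Structures using (IsEquivalence)
open import Relation.Nullary using (Dec; yes; no; contradiction)

infix 4 _≡_mod_

-- A record rather than a synonym for divisibility, so that x, y and n can be inferred.
record _≡_mod_ (x y : ℤ) (n : ℕ) : Set where
  constructor mod-divides
  field n∣x-y : + n Signed.∣ x - y
open _≡_mod_ using (n∣x-y)

module _ {n : ℕ} where

  ≡-mod-reflexive : ∀ {x y} → x ≡ y → x ≡ y mod n
  ≡-mod-reflexive {x} refl = mod-divides (Signed.divides 0ℤ (ℤ.+-inverseʳ x))

  ≡-mod-sym : ∀ {x y} → x ≡ y mod n → y ≡ x mod n
  ≡-mod-sym {x} {y} (mod-divides p) = mod-divides (subst (+ n Signed.∣_) (negate x y) (Signed.∣m⇒∣-m p))
    where negate : ∀ x y → - (x - y) ≡ y - x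
          negate = solve-∀

  ≡-mod-trans : ∀ {x y z} → x ≡ y mod n → y ≡ z mod n → x ≡ z mod n
  ≡-mod-trans {x} {y} {z} (mod-divides p) (mod-divides q) =
    mod-divides (subst (+ n Signed.∣_) (ℤ.+-minus-telescope x y z) (Signed.∣m∣n⇒∣m+n p q))

  ≡-mod-isEquivalence : IsEquivalence (λ x y → x ≡ y mod n)
  ≡-mod-isEquivalence = record
    { refl  = ≡-mod-reflexive refl
    ; sym   = ≡-mod-sym
    ; trans = ≡-mod-trans
    }

  +-congʳ-mod : ∀ {x y} z → x ≡ y mod n → x + z ≡ y + z mod n
  +-congʳ-mod {x} {y} z (mod-divides p) = mod-divides (subst (+ n Signed.∣_) (shift x y z) p)
    where shift : ∀ x y z → x - y ≡ (x + z) - (y + z)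
          shift = solve-∀

  *-congˡ-mod : ∀ {x y} c → x ≡ y mod n → c * x ≡ c * y mod n
  *-congˡ-mod {x} {y} c (mod-divides p) =
    mod-divides (subst (+ n Signed.∣_) (factor c x y) (Signed.∣n⇒∣m*n c p))
    where factor : ∀ c x y → c * (x - y) ≡ c * x - c * y
          factor = solve-∀

  *-congʳ-mod : ∀ {x y} c → x ≡ y mod n → x * c ≡ y * c mod n
  *-congʳ-mod {x} {y} c p =
    subst₂ (λ a b → a ≡ b mod n) (ℤ.*-comm c x) (ℤ.*-comm c y) (*-congˡ-mod c p)

  neg-cong-mod : ∀ {x y} → x ≡ y mod n → - x ≡ - y mod n
  neg-cong-mod {x} {y} (mod-divides p) =
    mod-divides (subst (+ n Signed.∣_) (distrib x y) (Signed.∣m⇒∣-m p))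
    where distrib : ∀ x y → - (x - y) ≡ - x - - y
          distrib = solve-∀

  n≡0-mod : + n ≡ 0ℤ mod n
  n≡0-mod = mod-divides (Signed.divides (+ 1) (trans (ℤ.+-identityʳ (+ n)) (sym (ℤ.*-identityˡ (+ n)))))

  x-n≡x-mod : ∀ x → x - + n ≡ x mod n
  x-n≡x-mod x = mod-divides (Signed.divides (- + 1) (shift x (+ n)))
    where shift : ∀ x n → x - n - x ≡ - + 1 * n
          shift = solve-∀

≡-mod-setoid : ℕ → Setoid _ _
≡-mod-setoid n = record { isEquivalence = ≡-mod-isEquivalence {n} }

module ≡-mod-Reasoning (n : ℕ) where
  open import Relation.Binary.Reasoning.Setoid (≡-mod-setoid n) public

≡-mod-divisor : ∀ {d n x y} → d ℕ.∣ n → x ≡ y mod n → x ≡ y mod d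
≡-mod-divisor {d} {n} d∣n (mod-divides p) = mod-divides (Signed.∣-trans (Signed.∣ᵤ⇒∣ {+ d} {+ n} d∣n) p)

-ℓ≡n∸ℓ-mod : ∀ {n ℓ} → ℓ ≤ n → - + ℓ ≡ + (n ℕ.∸ ℓ) mod n
-ℓ≡n∸ℓ-mod {n} {ℓ} ℓ≤n = begin
  - + ℓ           ≡⟨ ℤ.+-identityˡ (- + ℓ) ⟨
  0ℤ - + ℓ        ≈⟨ +-congʳ-mod (- + ℓ) (≡-mod-sym n≡0-mod) ⟩
  + n - + ℓ       ≡⟨ trans (ℤ.[+m]-[+n]≡m⊖n n ℓ) (ℤ.⊖-≥ ℓ≤n) ⟩
  + (n ℕ.∸ ℓ)     ∎
  where open ≡-mod-Reasoning n

≡-mod⇒≡ : ∀ {n a b} → a < n → b < n → + a ≡ + b mod n → a ≡ b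
≡-mod⇒≡ {n} {a} {b} a<n b<n p = ℤ.+-injective (ℤ.i-j≡0⇒i≡j (+ a) (+ b) (ℤ.∣i∣≡0⇒i≡0 distance≡0))
  where
  distance<n : ∣ + a - + b ∣ < n
  distance<n = subst (_< n) (cong ∣_∣ (sym (ℤ.m-n≡m⊖n a b)))
                 (ℕ.≤-<-trans (ℤ.∣m⊝n∣≤m⊔n a b) (ℕ.⊔-lub a<n b<n))
  distance≡0 : ∣ + a - + b ∣ ≡ 0
  distance≡0 with ∣ + a - + b ∣ | distance<n | Signed.∣⇒∣ᵤ (n∣x-y p)
  ... | zero  | _   | _   = refl
  ... | suc _ | d<n | n∣d = contradiction n∣d (ℕ.>⇒∤ d<n)

half : ℕ → ℕ
half n = n ℕ./ 2

half*2≤n : ∀ n → half n ℕ.* 2 ≤ n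
half*2≤n n = ℕ.m/n*n≤m n 2

n≤1+half*2 : ∀ n → n ≤ suc (half n ℕ.* 2)
n≤1+half*2 n = begin
  n                         ≡⟨ ℕ.m≡m%n+[m/n]*n n 2 ⟩
  n ℕ.% 2 ℕ.+ half n ℕ.* 2  ≤⟨ ℕ.+-monoˡ-≤ (half n ℕ.* 2) (ℕ.<⇒≤pred (ℕ.m%n<n n 2)) ⟩
  suc (half n ℕ.* 2)        ∎
  where open ℕ.≤-Reasoning

half<n : ∀ n → half (suc n) < suc n
half<n n = ℕ.m/n<m (suc n) 2 (ℕ.s≤s (ℕ.s≤s ℕ.z≤n))

1+half<n : ∀ n → 2 < n → suc (half n) < n
1+half<n n 2<n with half n | half*2≤n n
... | zero        | _     = ℕ.<-trans (ℕ.n<1+n 1) 2<n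
... | suc zero    | _     = 2<n
... | suc (suc h) | h*2≤n = ℕ.≤-trans (ℕ.s≤s (ℕ.s≤s (ℕ.s≤s (ℕ.s≤s (ℕ.m≤m*n h 2))))) h*2≤n

∣t-half∣≤half : ∀ {n t} → t < n → ∣ + t - + half n ∣ ≤ half n
∣t-half∣≤half {n} {t} t<n rewrite ℤ.[+m]-[+n]≡m⊖n t (half n) with ℕ.≤-total t (half n)
... | inj₁ t≤h rewrite ℤ.∣⊖∣-≤ t≤h = ℕ.m∸n≤m (half n) t
... | inj₂ h≤t rewrite ℤ.∣m⊖n∣≡∣n⊖m∣ t (half n) | ℤ.∣⊖∣-≤ h≤t =
  ℕ.m≤n+o⇒m∸n≤o t (half n)
    (ℕ.≤-pred (ℕ.≤-trans t<n (ℕ.≤-trans (n≤1+half*2 n) (ℕ.≤-reflexive (cong suc h*2≡h+h)))))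
  where h*2≡h+h = trans (ℕ.*-comm (half n) 2) (cong (half n ℕ.+_) (ℕ.+-identityʳ (half n)))

∣R∣≤half : ∀ n x → ∣ R (suc n) x ∣ ≤ half (suc n)
∣R∣≤half n x = ∣t-half∣≤half (n%ℕd<d (x + + half (suc n)) (suc n))

R+half≡residue : ∀ n x → R (suc n) x + + half (suc n) ≡ + ((x + + half (suc n)) %ℕ suc n)
R+half≡residue n x = minus-plus (+ ((x + + half (suc n)) %ℕ suc n)) (+ half (suc n))
  where minus-plus : ∀ r h → r - h + h ≡ r
        minus-plus = solve-∀

R-≡-mod : ∀ n x → x ≡ R (suc n) x mod suc n
R-≡-mod n x = mod-divides $ Signed.divides quotient $ begin
  x - (+ residue - h)                         ≡⟨ shift x (+ residue) h ⟩
  (x + h) - + residue                         ≡⟨ cong (_- + residue) (a≡a%ℕn+[a/ℕn]*n (x + h) (suc n)) ⟩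
  + residue + quotient * + suc n - + residue  ≡⟨ cancel (+ residue) (quotient * + suc n) ⟩
  quotient * + suc n                          ∎
  where
  open ≡-Reasoning
  h = + half (suc n)
  residue = (x + h) %ℕ suc n
  quotient = (x + h) /ℕ suc n
  shift : ∀ x r h → x - (r - h) ≡ (x + h) - r
  shift = solve-∀
  cancel : ∀ r y → r + y - r ≡ y
  cancel = solve-∀

R-unique : ∀ n x c {j} → j < suc n → c + + half (suc n) ≡ + j → c ≡ x mod suc n →
           R (suc n) x ≡ c
R-unique n x c {j} j<n c+h≡j c≡x =
  ∙-cancelʳ h (R (suc n) x) c (trans (R+half≡residue n x) (trans (cong +_ residue≡j) (sym c+h≡j)))
  where
  h = + half (suc n)
  residue = (x + h) %ℕ suc n
  residue≡j : residue ≡ j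
  residue≡j = ≡-mod⇒≡ (n%ℕd<d (x + h) (suc n)) j<n $ begin
    + residue        ≡⟨ R+half≡residue n x ⟨
    R (suc n) x + h  ≈⟨ +-congʳ-mod h (≡-mod-sym (R-≡-mod n x)) ⟩
    x + h            ≈⟨ +-congʳ-mod h (≡-mod-sym c≡x) ⟩
    c + h            ≡⟨ c+h≡j ⟩
    + j              ∎
    where open ≡-mod-Reasoning (suc n)

R≡-[n∸p] : ∀ n y {p} → p ≤ suc n → suc n ℕ.∸ p ≤ half (suc n) → y ≡ + p mod suc n →
           R (suc n) y ≡ - + (suc n ℕ.∸ p)
R≡-[n∸p] n y {p} p≤N d≤half y≡p =
  R-unique n y (- + d) (ℕ.≤-<-trans (ℕ.m∸n≤m (half N) d) (half<n n))
    (trans (ℤ.-m+n≡n⊖m d (half N)) (ℤ.⊖-≥ d≤half)) $ begin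
    - + d      ≡⟨ trans (ℤ.[+m]-[+n]≡m⊖n p N) (ℤ.⊖-≤ p≤N) ⟨
    + p - + N  ≈⟨ x-n≡x-mod (+ p) ⟩
    + p        ≈⟨ ≡-mod-sym y≡p ⟩
    y          ∎
  where
  N = suc n
  d = N ℕ.∸ p
  open ≡-mod-Reasoning N

inverse-mod : ∀ {k n} → gcd k n ≡ 1 → Σ ℤ λ r → r * + k ≡ + 1 mod n
inverse-mod {k} {n} gcd≡1 with coprime-Bézout (gcd≡1⇒coprime {k} {n} gcd≡1)
... | Bézout.Identity.+- x y eq = + x , mod-divides (Signed.divides (+ y) (begin
  + x * + k - + 1          ≡⟨ cong (_- + 1) (ℤ.pos-* x k) ⟨
  + (x ℕ.* k) - + 1        ≡⟨ cong (λ z → + z - + 1) eq ⟨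
  + 1 + + (y ℕ.* n) - + 1  ≡⟨ cancel (+ 1) (+ (y ℕ.* n)) ⟩
  + (y ℕ.* n)              ≡⟨ ℤ.pos-* y n ⟩
  + y * + n                ∎))
  where
  open ≡-Reasoning
  cancel : ∀ a b → a + b - a ≡ b
  cancel = solve-∀
... | Bézout.Identity.-+ x y eq = - + x , mod-divides (Signed.divides (- + y) (begin
  - + x * + k - + 1        ≡⟨ negate (+ x) (+ k) ⟩
  - (+ 1 + + x * + k)      ≡⟨ cong (λ z → - (+ 1 + z)) (ℤ.pos-* x k) ⟨
  - + (1 ℕ.+ x ℕ.* k)      ≡⟨ cong (λ z → - + z) eq ⟩
  - + (y ℕ.* n)            ≡⟨ cong -_ (ℤ.pos-* y n) ⟩
  - (+ y * + n)            ≡⟨ ℤ.neg-distribˡ-* (+ y) (+ n) ⟩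
  - + y * + n              ∎))
  where
  open ≡-Reasoning
  negate : ∀ a b → - a * b - + 1 ≡ - (+ 1 + a * b)
  negate = solve-∀

inverse-nonzero : ∀ {r k n} → 1 < n → r * + k ≡ + 1 mod n → r ≢ 0ℤ
inverse-nonzero {k = k} {n} 1<n rk≡1 refl
  with ≡-mod⇒≡ (ℕ.<-trans ℕ.z<s 1<n) 1<n (subst (_≡ + 1 mod n) (ℤ.*-zeroˡ (+ k)) rk≡1)
... | ()

2≤∣i∣⇒i≢0 : ∀ {i} → 2 ≤ ∣ i ∣ → i ≢ 0ℤ
2≤∣i∣⇒i≢0 2≤∣i∣ refl = contradiction 2≤∣i∣ λ ()

2≤∣multiplier∣ : ∀ {k ℓ n} m → k < n → 1 ≤ ℓ → ℓ < n → k ≢ ℓ → k ≢ n ℕ.∸ ℓ →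
                 + k * m ≡ + ℓ mod n → 2 ≤ ∣ m ∣
2≤∣multiplier∣ {k} {ℓ} {n} (+ zero) k<n 1≤ℓ ℓ<n _ _ km≡ℓ =
  contradiction (≡-mod⇒≡ (ℕ.≤-<-trans ℕ.z≤n k<n) ℓ<n (subst (_≡ + ℓ mod n) (ℤ.*-zeroʳ (+ k)) km≡ℓ))
                (ℕ.<⇒≢ 1≤ℓ)
2≤∣multiplier∣ {k} {ℓ} {n} +[1+ zero ] k<n _ ℓ<n k≢ℓ _ km≡ℓ =
  contradiction (≡-mod⇒≡ k<n ℓ<n (subst (_≡ + ℓ mod n) (ℤ.*-identityʳ (+ k)) km≡ℓ)) k≢ℓ
2≤∣multiplier∣ {k} {ℓ} {n} -[1+ zero ] k<n 1≤ℓ ℓ<n _ k≢n∸ℓ km≡ℓ =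
  contradiction (≡-mod⇒≡ k<n (ℕ.∸-monoʳ-< 1≤ℓ (ℕ.<⇒≤ ℓ<n)) k≡n∸ℓ) k≢n∸ℓ
  where
  open ≡-mod-Reasoning n
  k≡n∸ℓ : + k ≡ + (n ℕ.∸ ℓ) mod n
  k≡n∸ℓ = begin
    + k              ≡⟨ ℤ.neg-involutive (+ k) ⟨
    - (- + k)        ≡⟨ cong (λ z → - - z) (ℤ.*-identityʳ (+ k)) ⟨
    - - (+ k * + 1)  ≡⟨ cong -_ (ℤ.neg-distribʳ-* (+ k) (+ 1)) ⟩
    - (+ k * - + 1)  ≈⟨ neg-cong-mod km≡ℓ ⟩
    - + ℓ            ≈⟨ -ℓ≡n∸ℓ-mod (ℕ.<⇒≤ ℓ<n) ⟩
    + (n ℕ.∸ ℓ)      ∎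
2≤∣multiplier∣ +[1+ suc _ ] _ _ _ _ _ _ = ℕ.s≤s (ℕ.s≤s ℕ.z≤n)
2≤∣multiplier∣ -[1+ suc _ ] _ _ _ _ _ _ = ℕ.s≤s (ℕ.s≤s ℕ.z≤n)

common-divisor≤∣m∣ : ∀ {d n ℓ m} r → d ℕ.∣ n → d ℕ.∣ ℓ → m ≡ r * + ℓ mod n → m ≢ 0ℤ → d ≤ ∣ m ∣
common-divisor≤∣m∣ {d} {ℓ = ℓ} {m} r d∣n d∣ℓ m≡rℓ m≢0 =
  ℕ.∣⇒≤ ⦃ ℕ.≢-nonZero (m≢0 ∘ ℤ.∣i∣≡0⇒i≡0) ⦄ (Signed.∣⇒∣ᵤ d∣m)
  where
  d∣rℓ : + d Signed.∣ r * + ℓ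
  d∣rℓ = Signed.∣n⇒∣m*n r (Signed.∣ᵤ⇒∣ {+ d} {+ ℓ} d∣ℓ)
  d∣m : + d Signed.∣ m
  d∣m = Signed.∣m+n∣n⇒∣m (n∣x-y (≡-mod-divisor d∣n m≡rℓ)) (Signed.∣m⇒∣-m d∣rℓ)

[n/a]²≤n : ∀ n a .⦃ _ : ℕ.NonZero a ⦄ → n < a ℕ.* a → (n ℕ./ a) ℕ.* (n ℕ./ a) ≤ n
[n/a]²≤n n a n<a² = ℕ.≤-trans (ℕ.*-monoʳ-≤ (n ℕ./ a) (ℕ.<⇒≤ n/a<a)) (ℕ.m/n*n≤m n a)
  where n/a<a = ℕ.*-cancelʳ-< a (n ℕ./ a) a (ℕ.≤-<-trans (ℕ.m/n*n≤m n a) n<a²)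

sign◃*≡+ : ∀ m u → (sign m ◃ u) * m ≡ + (u ℕ.* ∣ m ∣)
sign◃*≡+ m u = begin
  (sign m ◃ u) * m                        ≡⟨ cong ((sign m ◃ u) *_) (ℤ.◃-inverse m) ⟨
  (sign m ◃ u) * (sign m ◃ ∣ m ∣)         ≡⟨ ℤ.◃-distrib-* (sign m) (sign m) u ∣ m ∣ ⟨
  (sign m Sign.* sign m) ◃ (u ℕ.* ∣ m ∣)  ≡⟨ cong (_◃ (u ℕ.* ∣ m ∣)) (Sign.s*s≡+ (sign m)) ⟩
  Sign.+ ◃ (u ℕ.* ∣ m ∣)                  ≡⟨ ℤ.+◃n≡+n (u ℕ.* ∣ m ∣) ⟩
  + (u ℕ.* ∣ m ∣)                         ∎
  where open ≡-Reasoning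

-- Alternatives (2) and (3) of the theorem are Witness k ℓ n and Witness ℓ k n.
Witness : ℕ → ℕ → ℕ → Set
Witness k ℓ n = Σ ℤ λ r → Σ ℤ λ u → r ≢ + 0 × u ≢ + 0 × LeSqrtℕ ∣ u ∣ n
  × (+ n ∣ (r * + k - + 1))
  × u * R n (r * + ℓ) ≢ R n (u * r * + ℓ)
  × LeSqrt (R n (u * r * + ℓ)) n

witness-from-small-multiplier : ∀ {k ℓ n} r m → 2 < suc n → r * + ℓ ≡ + 1 mod suc n →
  + k * m ≡ + ℓ mod suc n → 2 ≤ ∣ m ∣ → LeSqrtℕ ∣ m ∣ (suc n) → Witness ℓ k (suc n)
witness-from-small-multiplier {k} {ℓ} {n} r m 2<N rℓ≡1 km≡ℓ 2≤∣m∣ ∣m∣²≤N =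
  r , m , inverse-nonzero (ℕ.<-trans (ℕ.n<1+n 1) 2<N) rℓ≡1 , 2≤∣i∣⇒i≢0 2≤∣m∣ , ∣m∣²≤N ,
  Signed.∣⇒∣ᵤ (n∣x-y rℓ≡1) , m*R≢R , subst (λ c → LeSqrt c (suc n)) (sym R[mrk]≡1) (inj₂ (ℤ.+≤+ ℕ.z<s))
  where
  R[mrk]≡1 : R (suc n) (m * r * + k) ≡ + 1
  R[mrk]≡1 = R-unique n (m * r * + k) (+ 1) (1+half<n (suc n) 2<N) refl $ begin
    + 1              ≈⟨ ≡-mod-sym rℓ≡1 ⟩
    r * + ℓ          ≈⟨ *-congˡ-mod r (≡-mod-sym km≡ℓ) ⟩
    r * (+ k * m)    ≡⟨ reorder r (+ k) m ⟩
    m * r * + k      ∎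
    where
    open ≡-mod-Reasoning (suc n)
    reorder : ∀ r k m → r * (k * m) ≡ m * r * k
    reorder = solve-∀
  m*R≢R : m * R (suc n) (r * + k) ≢ R (suc n) (m * r * + k)
  m*R≢R eq = ℕ.<⇒≢ 2≤∣m∣ (sym (ℕ.m*n≡1⇒m≡1 ∣ m ∣ _
    (trans (sym (ℤ.abs-* m (R (suc n) (r * + k)))) (cong ∣_∣ (trans eq R[mrk]≡1)))))

large-residue-multiplier : ∀ n x → suc n < ∣ R (suc n) x ∣ ℕ.* ∣ R (suc n) x ∣ →
  Σ ℤ λ u → u ≢ 0ℤ × LeSqrtℕ ∣ u ∣ (suc n)
          × u * R (suc n) x ≢ R (suc n) (u * x) × R (suc n) (u * x) ℤ.≤ 0ℤ
large-residue-multiplier n x N<a² = u , u≢0 , ∣u∣²≤N , u*m≢R[ux] , R[ux]≤0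
  where
  N = suc n
  m = R N x
  a = ∣ m ∣
  instance
    a≢0 : ℕ.NonZero a
    a≢0 = ℕ.m*n≢0⇒m≢0 a ⦃ ℕ.>-nonZero (ℕ.<-trans ℕ.z<s N<a²) ⦄
  q = N ℕ./ a
  u = sign m ◃ q
  a≤half : a ≤ half N
  a≤half = ∣R∣≤half n x
  0<q : 0 < q
  0<q = ℕ.m≥n⇒m/n>0 (ℕ.<⇒≤ (ℕ.≤-<-trans a≤half (half<n n)))
  u≢0 : u ≢ 0ℤ
  u≢0 u≡0 = ℕ.<⇒≢ 0<q (sym (trans (sym (ℤ.abs-◃ (sign m) q)) (cong ∣_∣ u≡0)))
  ∣u∣²≤N : LeSqrtℕ ∣ u ∣ N
  ∣u∣²≤N rewrite ℤ.abs-◃ (sign m) q = [n/a]²≤n N a N<a²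
  N∸qa≤half : N ℕ.∸ q ℕ.* a ≤ half N
  N∸qa≤half = ℕ.≤-trans (ℕ.<⇒≤ (subst (_< a) (ℕ.m%n≡m∸m/n*n N a) (ℕ.m%n<n N a))) a≤half
  R[ux]≡qa-N : R N (u * x) ≡ - + (N ℕ.∸ q ℕ.* a)
  R[ux]≡qa-N = R≡-[n∸p] n (u * x) (ℕ.m/n*n≤m N a) N∸qa≤half $ begin
    u * x        ≈⟨ *-congˡ-mod u (R-≡-mod n x) ⟩
    u * m        ≡⟨ sign◃*≡+ m q ⟩
    + (q ℕ.* a)  ∎
    where open ≡-mod-Reasoning N
  R[ux]≤0 : R N (u * x) ℤ.≤ 0ℤ
  R[ux]≤0 = subst (ℤ._≤ 0ℤ) (sym R[ux]≡qa-N) ℤ.neg-≤-pos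
  u*m≢R[ux] : u * m ≢ R N (u * x)
  u*m≢R[ux] eq = ℕ.<⇒≱ 0<qa (ℤ.drop‿+≤+ (subst (ℤ._≤ 0ℤ) (trans (sym eq) (sign◃*≡+ m q)) R[ux]≤0))
    where 0<qa = ℕ.>-nonZero⁻¹ (q ℕ.* a) ⦃ ℕ.m*n≢0 q a ⦃ ℕ.>-nonZero 0<q ⦄ ⦄

witnesses-from-inverse : ∀ {k ℓ n} r → r * + k ≡ + 1 mod suc n →
  k < suc n → 1 ≤ ℓ → ℓ < suc n → k ≢ ℓ → k ≢ suc n ℕ.∸ ℓ → 2 < suc n →
  gcd ℓ (suc n) ≡ 1 ⊎ suc n < gcd ℓ (suc n) ℕ.* gcd ℓ (suc n) →
  Witness k ℓ (suc n) ⊎ Witness ℓ k (suc n)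
witnesses-from-inverse {k} {ℓ} {n} r rk≡1 k<N 1≤ℓ ℓ<N k≢ℓ k≢N∸ℓ 2<N gcd[ℓ,N]-cases =
  split (∣ m ∣ ℕ.* ∣ m ∣ ℕ.≤? N)
  where
  N = suc n
  m = R N (r * + ℓ)
  m≡rℓ : m ≡ r * + ℓ mod N
  m≡rℓ = ≡-mod-sym (R-≡-mod n (r * + ℓ))
  km≡ℓ : + k * m ≡ + ℓ mod N
  km≡ℓ = begin
    + k * m          ≈⟨ *-congˡ-mod (+ k) m≡rℓ ⟩
    + k * (r * + ℓ)  ≡⟨ reorder (+ k) r (+ ℓ) ⟩
    r * + k * + ℓ    ≈⟨ *-congʳ-mod (+ ℓ) rk≡1 ⟩
    + 1 * + ℓ        ≡⟨ ℤ.*-identityˡ (+ ℓ) ⟩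
    + ℓ              ∎
    where
    open ≡-mod-Reasoning N
    reorder : ∀ k r l → k * (r * l) ≡ r * k * l
    reorder = solve-∀
  2≤∣m∣ : 2 ≤ ∣ m ∣
  2≤∣m∣ = 2≤∣multiplier∣ m k<N 1≤ℓ ℓ<N k≢ℓ k≢N∸ℓ km≡ℓ
  gcd[ℓ,N]≡1 : gcd ℓ N ≡ 1 ⊎ N < gcd ℓ N ℕ.* gcd ℓ N → LeSqrtℕ ∣ m ∣ N → gcd ℓ N ≡ 1
  gcd[ℓ,N]≡1 (inj₁ gcd≡1) _      = gcd≡1
  gcd[ℓ,N]≡1 (inj₂ N<g²) ∣m∣²≤N =
    contradiction (ℕ.≤-trans (ℕ.*-mono-≤ g≤∣m∣ g≤∣m∣) ∣m∣²≤N) (ℕ.<⇒≱ N<g²)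
    where g≤∣m∣ = common-divisor≤∣m∣ r (gcd[m,n]∣n ℓ N) (gcd[m,n]∣m ℓ N) m≡rℓ (2≤∣i∣⇒i≢0 2≤∣m∣)
  split : Dec (LeSqrtℕ ∣ m ∣ N) → Witness k ℓ N ⊎ Witness ℓ k N
  split (yes ∣m∣²≤N) =
    let r′ , r′ℓ≡1 = inverse-mod {ℓ} (gcd[ℓ,N]≡1 gcd[ℓ,N]-cases ∣m∣²≤N)
    in inj₂ (witness-from-small-multiplier r′ m 2<N r′ℓ≡1 km≡ℓ 2≤∣m∣ ∣m∣²≤N)
  split (no ∣m∣²≰N) =
    let u , u≢0 , ∣u∣²≤N , u*m≢R , R≤0 = large-residue-multiplier n (r * + ℓ) (ℕ.≰⇒> ∣m∣²≰N)
        assoc = sym (ℤ.*-assoc u r (+ ℓ))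
    in inj₁ (r , u , inverse-nonzero (ℕ.<-trans (ℕ.n<1+n 1) 2<N) rk≡1 , u≢0 , ∣u∣²≤N ,
             Signed.∣⇒∣ᵤ (n∣x-y rk≡1) , subst (λ c → u * m ≢ R N c) assoc u*m≢R ,
             subst (λ c → LeSqrt (R N c) N) assoc (inj₁ R≤0))

SmallCommonFactor : ℕ → ℕ → Set
SmallCommonFactor x n = 1 < gcd x n × LeSqrtℕ (gcd x n) n

gcd-cases : ∀ x n → SmallCommonFactor x (suc n)
  ⊎ gcd x (suc n) ≡ 1 ⊎ suc n < gcd x (suc n) ℕ.* gcd x (suc n)
gcd-cases x n with 1 ℕ.<? gcd x (suc n) | gcd x (suc n) ℕ.* gcd x (suc n) ℕ.≤? suc n
... | yes 1<g | yes g²≤N = inj₁ (1<g , g²≤N)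
... | yes _   | no g²≰N  = inj₂ (inj₂ (ℕ.≰⇒> g²≰N))
... | no 1≮g  | _        = inj₂ (inj₁ (ℕ.≤-antisym (ℕ.≮⇒≥ 1≮g) (ℕ.n≢0⇒n>0 g≢0)))
  where g≢0 : gcd x (suc n) ≢ 0
        g≢0 g≡0 = contradiction (gcd[m,n]≡0⇒n≡0 x g≡0) λ ()

distinct-positives⇒2<n : ∀ {k ℓ n} → 1 ≤ k → k < n → 1 ≤ ℓ → ℓ < n → k ≢ ℓ → 2 < n
distinct-positives⇒2<n {suc (suc _)} _ k<n _ _    _   = ℕ.≤-trans (ℕ.s≤s (ℕ.s≤s (ℕ.s≤s ℕ.z≤n))) k<n
distinct-positives⇒2<n {suc zero} {suc (suc _)} _ _ _ ℓ<n _ = ℕ.≤-trans (ℕ.s≤s (ℕ.s≤s (ℕ.s≤s ℕ.z≤n))) ℓ<n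
distinct-positives⇒2<n {suc zero} {suc zero} _ _ _ _ k≢ℓ = contradiction refl k≢ℓ

≢-complement-sym : ∀ {k ℓ n} → k ≤ n → k ≢ n ℕ.∸ ℓ → ℓ ≢ n ℕ.∸ k
≢-complement-sym {k} {ℓ} {n} k≤n k≢n∸ℓ ℓ≡n∸k =
  k≢n∸ℓ (trans (sym (ℕ.m∸[m∸n]≡n k≤n)) (cong (n ℕ.∸_) (sym ℓ≡n∸k)))

gcd-of-gcds≡1 : ∀ k ℓ n → gcd (gcd k ℓ) n ≡ 1 → gcd (gcd k n) (gcd ℓ n) ≡ 1
gcd-of-gcds≡1 k ℓ n gcd≡1 = ℕ.∣1⇒≡1 (subst (g ℕ.∣_) gcd≡1 (gcd-greatest (gcd-greatest g∣k g∣ℓ) g∣n))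
  where
  g = gcd (gcd k n) (gcd ℓ n)
  g∣k = ℕ.∣-trans (gcd[m,n]∣m (gcd k n) (gcd ℓ n)) (gcd[m,n]∣m k n)
  g∣ℓ = ℕ.∣-trans (gcd[m,n]∣n (gcd k n) (gcd ℓ n)) (gcd[m,n]∣m ℓ n)
  g∣n = ℕ.∣-trans (gcd[m,n]∣m (gcd k n) (gcd ℓ n)) (gcd[m,n]∣n k n)

coprime-divisors⇒product∣ : ∀ {a b n} → gcd a b ≡ 1 → a ℕ.∣ n → b ℕ.∣ n → a ℕ.* b ℕ.∣ n
coprime-divisors⇒product∣ {a} {b} gcd≡1 a∣n b∣n = subst (ℕ._∣ _) lcm≡ab (lcm-least a∣n b∣n)
  where
  lcm≡ab = trans (sym (ℕ.*-identityˡ (lcm a b))) (trans (cong (ℕ._* lcm a b) (sym gcd≡1)) (gcd*lcm a b))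

coprime-divisors-not-both-large : ∀ {a b n} → gcd a b ≡ 1 → a ℕ.∣ suc n → b ℕ.∣ suc n →
  suc n < a ℕ.* a → suc n < b ℕ.* b → ⊥
coprime-divisors-not-both-large {a} {b} {n} gcd≡1 a∣N b∣N N<a² N<b² =
  [ (λ a≤b → ℕ.<⇒≱ N<a² (ℕ.≤-trans (ℕ.*-monoʳ-≤ a a≤b) ab≤N))
  , (λ b≤a → ℕ.<⇒≱ N<b² (ℕ.≤-trans (ℕ.*-monoˡ-≤ b b≤a) ab≤N))
  ] (ℕ.≤-total a b)
  where
  ab≤N : a ℕ.* b ≤ suc n
  ab≤N = ℕ.∣⇒≤ (coprime-divisors⇒product∣ gcd≡1 a∣N b∣N)

lemma6p8 : (k ℓ n : ℕ) → 1 ≤ k → k < n → 1 ≤ ℓ → ℓ < n →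
  gcd (gcd k ℓ) n ≡ 1 → k ≢ ℓ → k ≢ n ℕ.∸ ℓ →
  ((1 < gcd k n × LeSqrtℕ (gcd k n) n) ⊎ (1 < gcd ℓ n × LeSqrtℕ (gcd ℓ n) n))
  ⊎ ((Σ ℤ λ r → Σ ℤ λ u → r ≢ + 0 × u ≢ + 0 × LeSqrtℕ ∣ u ∣ n
        × (+ n ∣ (r * + k - + 1))
        × u * R n (r * + ℓ) ≢ R n (u * r * + ℓ)
        × LeSqrt (R n (u * r * + ℓ)) n)
    ⊎ (Σ ℤ λ r → Σ ℤ λ u → r ≢ + 0 × u ≢ + 0 × LeSqrtℕ ∣ u ∣ n
        × (+ n ∣ (r * + ℓ - + 1))
        × u * R n (r * + k) ≢ R n (u * r * + k)
        × LeSqrt (R n (u * r * + k)) n))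
lemma6p8 k ℓ zero _ () _ _ _ _ _
lemma6p8 k ℓ (suc n) 1≤k k<N 1≤ℓ ℓ<N gcd≡1 k≢ℓ k≢N∸ℓ
  with gcd-cases k n | gcd-cases ℓ n | distinct-positives⇒2<n 1≤k k<N 1≤ℓ ℓ<N k≢ℓ
... | inj₁ k-small            | _                      | _   = inj₁ (inj₁ k-small)
... | inj₂ _                  | inj₁ ℓ-small           | _   = inj₁ (inj₂ ℓ-small)
... | inj₂ (inj₁ gcd[k,N]≡1)  | inj₂ ℓ-cases           | 2<N =
  let r , rk≡1 = inverse-mod {k} gcd[k,N]≡1
  in inj₂ (witnesses-from-inverse r rk≡1 k<N 1≤ℓ ℓ<N k≢ℓ k≢N∸ℓ 2<N ℓ-cases)
... | inj₂ (inj₂ k-large)     | inj₂ (inj₁ gcd[ℓ,N]≡1) | 2<N =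
  let r , rℓ≡1 = inverse-mod {ℓ} gcd[ℓ,N]≡1
  in inj₂ (swap (witnesses-from-inverse r rℓ≡1 ℓ<N 1≤k k<N (k≢ℓ ∘ sym)
                  (≢-complement-sym (ℕ.<⇒≤ k<N) k≢N∸ℓ) 2<N (inj₂ k-large)))
... | inj₂ (inj₂ k-large)     | inj₂ (inj₂ ℓ-large)    | _   =
  ⊥-elim (coprime-divisors-not-both-large (gcd-of-gcds≡1 k ℓ (suc n) gcd≡1)
            (gcd[m,n]∣n k (suc n)) (gcd[m,n]∣n ℓ (suc n)) k-large ℓ-large)
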